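{- $(\cdot)^\perp$ is an involutive contravariant functor (on $\mathbf{Int}$), whose action on morphisms is $r\mapsto r^\sim$.
   Context: An interface $X$ is $(|X|,P_X)$ with $P_X$ a monotonic predicate transformer on $\mathcal{P}(|X|)$; seeds are $x$ with $x\subseteq P_X(x)$. Dual $X^\perp=(|X|,x\mapsto\overline{P_X(\overline{x})})$; tensor on $|X|\times|Y|$ with $r\mapsto\bigcup_{x\times y\subseteq r}P_X(x)\times P_Y(y)$; par $X\mathbin{\text{⅋}}Y=(X^\perp\otimes Y^\perp)^\perp$; $X\multimap Y=X^\perp\mathbin{\text{⅋}}Y$. $\mathbf{Int}$ is the category with interfaces as objects, seeds of $X\multimap Y$ as morphisms $X\to Y$, relational composition and identity relations; $r^\sim$ is the converse relation. -}

module Defs where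

open import Level using (0ℓ)
open import Data.Product using (Σ; _×_; _,_; proj₁; proj₂)
open import Relation.Nullary using (¬_)
open import Relation.Binary.PropositionalEquality using (_≡_)
open import Function.Bundles using (_⇔_)

Subset : Set → Set₁
Subset A = A → Set

_⊆_ : ∀ {ℓ ℓ'} {A : Set} → (A → Set ℓ) → (A → Set ℓ') → Set _
x ⊆ y = ∀ a → x a → y a

∁ : {A : Set} → Subset A → Subset A
∁ x a = ¬ x a

record Interface : Set₁ where
  field
    ∣_∣  : Set
    P    : Subset ∣_∣ → Subset ∣_∣
    mono : ∀ (x y : Subset ∣_∣) → x ⊆ y → P x ⊆ P y
open Interface public

IsSeed : (X : Interface) → Subset ∣ X ∣ → Set
IsSeed X x = x ⊆ P X x

_⊥ : Interface → Interface
∣ X ⊥ ∣ = ∣ X ∣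
P (X ⊥) x = ∁ (P X (∁ x))
mono (X ⊥) x y x⊆y a ¬Px̄ Pȳ =
  ¬Px̄ (mono X (∁ y) (∁ x) (λ b ¬yb xb → ¬yb (x⊆y b xb)) a Pȳ)

Rel : Interface → Interface → Set₁
Rel X Y = Subset (∣ X ∣ × ∣ Y ∣)

-- Predicate transformer of the tensor X ⊗ Y on |X| × |Y|:
--   r ↦ ⋃_{x × y ⊆ r} P_X(x) × P_Y(y).
-- (The union ranges over all subsets, so the result lives in Set₁.)
tensorP : (X Y : Interface) → Rel X Y → (∣ X ∣ × ∣ Y ∣ → Set₁)
tensorP X Y r (a , b) =
  Σ (Subset ∣ X ∣) λ x → Σ (Subset ∣ Y ∣) λ y →
    (∀ a' b' → x a' → y b' → r (a' , b')) × P X x a × P Y y b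

parP : (X Y : Interface) → Rel X Y → (∣ X ∣ × ∣ Y ∣ → Set₁)
parP X Y r p = ¬ tensorP (X ⊥) (Y ⊥) (∁ r) p

linP : (X Y : Interface) → Rel X Y → (∣ X ∣ × ∣ Y ∣ → Set₁)
linP X Y r = parP (X ⊥) Y r

IsMorphism : (X Y : Interface) → Rel X Y → Set₁
IsMorphism X Y r = r ⊆ linP X Y r

idRel : (X : Interface) → Rel X X
idRel X (a , a') = a ≡ a'

_⨾_ : {X Y Z : Interface} → Rel X Y → Rel Y Z → Rel X Z
_⨾_ {Y = Y} r s (a , c) = Σ ∣ Y ∣ λ b → r (a , b) × s (b , c)

_~ : {X Y : Interface} → Rel X Y → Rel Y X
(r ~) (b , a) = r (a , b)

_≐_ : {A : Set} → Subset A → Subset A → Set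
x ≐ y = ∀ a → x a ⇔ y a

-- Only the involution X^⊥⊥ = X is classical. The rest is constructive: the
-- inclusion P_X ⊆ P_{X^⊥⊥} holds outright, so every dual X^⊥ already satisfies
-- P_{X^⊥⊥⊥} = P_{X^⊥}, and this is all that r ↦ r~ needs to send morphisms
-- X → Y to morphisms Y^⊥ → X^⊥ (the tensor witness for r~ is flipped into one for r).
module Submission where

open import Defs
open import Level using (0ℓ)
open import Data.Product using (_×_; _,_; map₂; swap)
open import Function.Base using (id)
open import Function.Bundles using (_⇔_; mk⇔)
open import Relation.Binary.PropositionalEquality using (sym)
open import Axiom.ExcludedMiddle using (ExcludedMiddle)
open import Axiom.DoubleNegationElimination using (DoubleNegationElimination; em⇒dne)

P⊆P⊥⊥ : (X : Interface) (x : Subset ∣ X ∣) → P X x ⊆ P ((X ⊥) ⊥) x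
P⊆P⊥⊥ X x a Px ¬Px̄̄ = ¬Px̄̄ (mono X x (∁ (∁ x)) (λ b xb ¬xb → ¬xb xb) a Px)

P⊥⊥⊥⊆P⊥ : (X : Interface) (x : Subset ∣ X ∣) → P (((X ⊥) ⊥) ⊥) x ⊆ P (X ⊥) x
P⊥⊥⊥⊆P⊥ X x a ¬P⊥⊥x̄ Px̄ = ¬P⊥⊥x̄ (P⊆P⊥⊥ X (∁ x) a Px̄)

P⊥⊥⊆P : DoubleNegationElimination 0ℓ →
        (X : Interface) (x : Subset ∣ X ∣) → P ((X ⊥) ⊥) x ⊆ P X x
P⊥⊥⊆P dne X x a ¬¬Px̄̄ = mono X (∁ (∁ x)) x (λ b → dne) a (dne ¬¬Px̄̄)

⊥-involutive : DoubleNegationElimination 0ℓ →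
               (X : Interface) (x : Subset ∣ X ∣) → P ((X ⊥) ⊥) x ≐ P X x
⊥-involutive dne X x a = mk⇔ (P⊥⊥⊆P dne X x a) (P⊆P⊥⊥ X x a)

~-isMorphism : (X Y : Interface) (r : Rel X Y) →
               IsMorphism X Y r → IsMorphism (Y ⊥) (X ⊥) (_~ {X} {Y} r)
~-isMorphism X Y r r⊆linP (b , a) rab (y , x , y×x⊆∁r~ , Py , Px) =
  r⊆linP (a , b) rab
    (x , y , (λ a' b' xa' yb' → y×x⊆∁r~ b' a' yb' xa') , Px , P⊥⊥⊥⊆P⊥ Y y b Py)

~-idRel : (X : Interface) → _~ {X} {X} (idRel X) ≐ idRel (X ⊥)
~-idRel X p = mk⇔ sym sym

~-⨾ : (X Y Z : Interface) (r : Rel X Y) (s : Rel Y Z) →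
      _~ {X} {Z} (_⨾_ {X} {Y} {Z} r s)
        ≐ _⨾_ {Z ⊥} {Y ⊥} {X ⊥} (_~ {Y} {Z} s) (_~ {X} {Y} r)
~-⨾ X Y Z r s p = mk⇔ (map₂ swap) (map₂ swap)

~-involutive : (X Y : Interface) (r : Rel X Y) → _~ {Y} {X} (_~ {X} {Y} r) ≐ r
~-involutive X Y r p = mk⇔ id id

lemma10 : ExcludedMiddle 0ℓ →
    ((X Y : Interface) (r : Rel X Y) →
       IsMorphism X Y r → IsMorphism (Y ⊥) (X ⊥) (_~ {X} {Y} r))
    × ((X : Interface) → _~ {X} {X} (idRel X) ≐ idRel (X ⊥))
    × ((X Y Z : Interface) (r : Rel X Y) (s : Rel Y Z) →
         _~ {X} {Z} (_⨾_ {X} {Y} {Z} r s)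
           ≐ _⨾_ {Z ⊥} {Y ⊥} {X ⊥} (_~ {Y} {Z} s) (_~ {X} {Y} r))
    × ((X : Interface) → (x : Subset ∣ X ∣) → P ((X ⊥) ⊥) x ≐ P X x)
    × ((X Y : Interface) (r : Rel X Y) → _~ {Y} {X} (_~ {X} {Y} r) ≐ r)
lemma10 em =
  ~-isMorphism , ~-idRel , ~-⨾ , ⊥-involutive (em⇒dne em) , ~-involutive
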